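{- Let $G$ be a (finite, simple, connected) graph of order $n$ that is not the complete graph $K_n$. If $W$ is a $\tau$-set of $G$ such that $G[W]$ is a complete graph $K_{\tau(G)}$, then $\beta_p(G)\ge \tau(G)+1$.
   Context: Two vertices $u,v$ are twins if $N(u)\setminus\{v\}=N(v)\setminus\{u\}$. A twin set is a set of pairwise twin vertices; twin classes are the equivalence classes of the twin relation and $\tau(G)$ is the maximum cardinality of a twin class. A $\tau$-set is a twin set of cardinality $\tau(G)$. $G[W]$ is the subgraph induced by $W$. For $u$ a vertex and $S$ a vertex set, $d(u,S)=\min_{w\in S}d(u,w)$. A partition $\Pi=\{S_1,\dots,S_k\}$ of $V(G)$ is locating if the vectors $r(u|\Pi)=(d(u,S_1),\dots,d(u,S_k))$ are pairwise distinct over $u\in V(G)$; $\beta_p(G)$ is the minimum size of a locating partition. -}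

module Defs where

open import Data.Nat using (ℕ; zero; suc; _≤_)
open import Data.Fin using (Fin)
open import Data.Fin.Subset using (Subset; _∈_; ∣_∣)
open import Data.Bool using (Bool; true; false)
open import Data.Product using (Σ; _×_; _,_; proj₁; ∃; ∃-syntax)
open import Relation.Binary.PropositionalEquality using (_≡_; _≢_)
open import Relation.Nullary using (¬_)
open import Function.Bundles using (_⇔_)

record Graph (n : ℕ) : Set where
  field
    adj   : Fin n → Fin n → Bool
    sym   : ∀ u v → adj u v ≡ adj v u
    irrefl : ∀ u → adj u u ≡ false
open Graph public

module _ {n : ℕ} (G : Graph n) where

  Adj : Fin n → Fin n → Set
  Adj u v = adj G u v ≡ true

  data Walk : Fin n → Fin n → ℕ → Set where
    here : ∀ {u} → Walk u u zero
    step : ∀ {u w v k} → Adj u w → Walk w v k → Walk u v (suc k)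

  Connected : Set
  Connected = ∀ u v → ∃[ k ] Walk u v k

  Complete : Set
  Complete = ∀ u v → u ≢ v → Adj u v

  Dist : Fin n → Fin n → ℕ → Set
  Dist u v d = Walk u v d × (∀ k → Walk u v k → d ≤ k)

  InN : Fin n → Fin n → Set
  InN u w = Adj u w

  Twins : Fin n → Fin n → Set
  Twins u v = ∀ w → (InN u w × w ≢ v) ⇔ (InN v w × w ≢ u)

  TwinSet : Subset n → Set
  TwinSet W = ∀ u v → u ∈ W → v ∈ W → Twins u v

  TauSet : Subset n → Set
  TauSet W = TwinSet W × (∀ W' → TwinSet W' → ∣ W' ∣ ≤ ∣ W ∣)

  CliqueOn : Subset n → Set
  CliqueOn W = ∀ u v → u ∈ W → v ∈ W → u ≢ v → Adj u v

  -- An ordered partition into k (nonempty) classes S_0..S_{k-1},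
  -- given by the class function c : vertex ↦ index of its class.
  Partition : ℕ → Set
  Partition k = Σ (Fin n → Fin k) λ c → ∀ i → ∃[ w ] c w ≡ i

  DistToClass : ∀ {k} → (Fin n → Fin k) → Fin n → Fin k → ℕ → Set
  DistToClass c u i m =
    (∃[ w ] (c w ≡ i × Dist u w m)) ×
    (∀ w m' → c w ≡ i → Dist u w m' → m ≤ m')

  Locating : ∀ {k} → Partition k → Set
  Locating {k} (c , _) = ∀ u v → u ≢ v →
    ∃[ i ] ∃[ m ] ∃[ m' ] (DistToClass c u i m × DistToClass c v i m' × m ≢ m')

module Submission where

-- 1. Two twins lying in the same class have the same distance vector: the
--    distance to their own class is 0, and any walk from one twin to a vertex
--    of another class can be rerouted to start at the other twin without
--    getting longer.  Hence a locating partition puts the vertices of W into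
--    pairwise distinct classes, i.e. the class map is injective on W.
-- 2. If W nevertheless met every class, then W would be all of V(G): a vertex
--    outside W yields (by connectivity) an edge y z with y ∉ W, z ∈ W; then y
--    is adjacent to all of W, so y and the vertex of W in y's class have a
--    common neighbour in every other class, hence equal distance vectors.
--    Since G[W] is complete, G would be complete.
-- 3. So the class map restricted to W is injective and misses a class, which
--    gives |W| < k by a counting argument.

open import Defs hiding (sym)
open import Data.Nat using (ℕ; zero; suc; _+_; _≤_; _<_; z≤n; s≤s)
open import Data.Nat.Properties
  using (≤-refl; ≤-trans; ≤-antisym; n≤1+n; ≮⇒≥; m<1+n⇒m<n∨m≡n; +-suc; +-identityʳ)
open import Data.Fin using (Fin) renaming (zero to fzero; suc to fsuc)
open import Data.Fin.Properties
  using (any?; all?; ¬∀⟶∃¬; injective⇒≤; suc-injective) renaming (_≟_ to _≟F_)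
open import Data.Fin.Subset using (Subset; ∣_∣; _∈_; _∉_)
open import Data.Fin.Subset.Properties using (_∈?_)
open import Data.Vec.Base using ([]; _∷_; here; there)
open import Data.Vec.Functional using (Vector) renaming (_∷_ to _◂_)
open import Data.Bool using (true; false) renaming (_≟_ to _≟B_)
open import Data.Product using (_×_; _,_; proj₁; proj₂; ∃-syntax; Σ-syntax)
open import Data.Sum using (inj₁; inj₂)
open import Data.Empty using (⊥-elim)
open import Relation.Binary.PropositionalEquality using (_≡_; _≢_; refl; sym; trans; cong; subst)
open import Relation.Nullary using (¬_; Dec; yes; no)
open import Relation.Nullary.Decidable using (map′; _×-dec_)
open import Relation.Unary using (Decidable)
open import Function.Bundles using (Equivalence)
open import Function.Definitions using (Injective)

leastWitness : ∀ {P : ℕ → Set} → Decidable P → ∀ {j} → P j →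
  ∃[ d ] (P d × (∀ k → P k → d ≤ k))
leastWitness {P} P? {j} pj = scan j 0 (λ _ ()) (subst P (sym (+-identityʳ j)) pj)
  where
  -- scan upwards from d, knowing that nothing below d satisfies P and that
  -- r + d does
  scan : ∀ r d → (∀ i → i < d → ¬ P i) → P (r + d) → ∃[ d ] (P d × (∀ k → P k → d ≤ k))
  scan r d below p with P? d
  ... | yes pd = d , pd , λ k pk → ≮⇒≥ (λ k<d → below k k<d pk)
  scan zero    d below p | no ¬pd = ⊥-elim (¬pd p)
  scan (suc r) d below p | no ¬pd = scan r (suc d) below′ (subst P (sym (+-suc r d)) p)
    where
    below′ : ∀ i → i < suc d → ¬ P i
    below′ i i<1+d with m<1+n⇒m<n∨m≡n i<1+d
    ... | inj₁ i<d  = below i i<d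
    ... | inj₂ refl = ¬pd

consInjective : ∀ {A : Set} {m} (a : A) (f : Vector A m) →
  Injective _≡_ _≡_ f → (∀ j → f j ≢ a) → Injective _≡_ _≡_ (a ◂ f)
consInjective a f f-inj fresh {fzero}  {fzero}  _  = refl
consInjective a f f-inj fresh {fzero}  {fsuc y} eq = ⊥-elim (fresh y (sym eq))
consInjective a f f-inj fresh {fsuc x} {fzero}  eq = ⊥-elim (fresh x eq)
consInjective a f f-inj fresh {fsuc x} {fsuc y} eq = cong fsuc (f-inj eq)

injectiveMissing⇒< : ∀ {m k} (f : Fin m → Fin k) (a : Fin k) →
  Injective _≡_ _≡_ f → (∀ j → f j ≢ a) → suc m ≤ k
injectiveMissing⇒< f a f-inj fresh = injective⇒≤ (consInjective a f f-inj fresh)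

enumerate : ∀ {n} (W : Subset n) →
  Σ[ e ∈ (Fin ∣ W ∣ → Fin n) ] ((∀ j → e j ∈ W) × Injective _≡_ _≡_ e)
enumerate [] = (λ ()) , (λ ()) , λ { {()} }
enumerate (false ∷ W) with enumerate W
... | e , e∈W , e-inj = (λ j → fsuc (e j)) , (λ j → there (e∈W j)) , λ eq → e-inj (suc-injective eq)
enumerate (true ∷ W) with enumerate W
... | e , e∈W , e-inj =
  fzero ◂ (λ j → fsuc (e j)) , members ,
  consInjective fzero _ (λ eq → e-inj (suc-injective eq)) (λ _ ())
  where
  members : ∀ j → (fzero ◂ (λ j → fsuc (e j))) j ∈ (true ∷ W)
  members fzero    = here
  members (fsuc j) = there (e∈W j)

injectiveOnMissing⇒< : ∀ {n k} (W : Subset n) (c : Fin n → Fin k) (a : Fin k) →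
  (∀ u v → u ∈ W → v ∈ W → c u ≡ c v → u ≡ v) → (∀ w → w ∈ W → c w ≢ a) →
  suc ∣ W ∣ ≤ k
injectiveOnMissing⇒< W c a c-inj fresh with enumerate W
... | e , e∈W , e-inj =
  injectiveMissing⇒< (λ j → c (e j)) a
    (λ {x} {y} eq → e-inj (c-inj (e x) (e y) (e∈W x) (e∈W y) eq))
    (λ j → fresh (e j) (e∈W j))

module _ {n : ℕ} (G : Graph n) where

  adjSym : ∀ {u v} → Adj G u v → Adj G v u
  adjSym {u} {v} uv = trans (Graph.sym G v u) uv

  walk? : ∀ u w k → Dec (Walk G u w k)
  walk? u w zero = map′ (λ { refl → here }) (λ { here → refl }) (u ≟F w)
  walk? u w (suc k) =
    map′ (λ (a , ua , aw) → step ua aw) (λ { (step {w = a} ua aw) → a , ua , aw })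
      (any? (λ a → (adj G u a ≟B true) ×-dec walk? a w k))

  shortestWalk : ∀ {u w j} → Walk G u w j → ∃[ d ] (d ≤ j × Dist G u w d)
  shortestWalk {u} {w} {j} uw with leastWitness (walk? u w) uw
  ... | d , ud , minimal = d , minimal j uw , ud , minimal

  -- A walk from a to w ≠ a can be rerouted to start at a twin b of a,
  -- without getting longer: swap the first step a → x for b → x, or drop it
  -- when x = b.
  rerouteAtTwin : ∀ {a b w j} → Twins G a b → Walk G a w j → w ≢ a →
    ∃[ j′ ] (j′ ≤ j × Walk G b w j′)
  rerouteAtTwin twins here w≢a = ⊥-elim (w≢a refl)
  rerouteAtTwin {b = b} {j = suc j} twins (step {w = x} ax xw) w≢a with x ≟F b
  ... | yes refl = j , n≤1+n j , xw
  ... | no x≢b   = suc j , ≤-refl , step (proj₁ (Equivalence.to (twins x) (ax , x≢b))) xw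

  crossingEdge : ∀ (W : Subset n) {x w j} → Walk G x w j → x ∉ W → w ∈ W →
    ∃[ y ] ∃[ z ] (y ∉ W × z ∈ W × Adj G y z)
  crossingEdge W here x∉W w∈W = ⊥-elim (x∉W w∈W)
  crossingEdge W {x} (step {w = a} xa aw) x∉W w∈W with a ∈? W
  ... | yes a∈W = x , a , x∉W , a∈W , xa
  ... | no  a∉W = crossingEdge W aw a∉W w∈W

  adjacentToTwinSet : ∀ {W y z} → TwinSet G W → y ∉ W → z ∈ W → Adj G y z →
    ∀ t → t ∈ W → Adj G y t
  adjacentToTwinSet {y = y} twinSet y∉W z∈W yz t t∈W =
    adjSym (proj₁ (Equivalence.to (twinSet _ t z∈W t∈W y) (adjSym yz , y≢t)))
    where
    y≢t : y ≢ t
    y≢t refl = y∉W t∈W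

  module _ {k : ℕ} (c : Fin n → Fin k) where

    SameVector : Fin n → Fin n → Set
    SameVector u v = ∀ i m m′ → DistToClass G c u i m → DistToClass G c v i m′ → m ≡ m′

    distToClass≤walk : ∀ {u i m w j} → DistToClass G c u i m → c w ≡ i → Walk G u w j → m ≤ j
    distToClass≤walk (_ , minimal) cw≡i uw with shortestWalk uw
    ... | d , d≤j , dist = ≤-trans (minimal _ d cw≡i dist) d≤j

    distToOwnClass : ∀ {u m} → DistToClass G c u (c u) m → m ≡ 0
    distToOwnClass du with distToClass≤walk du refl here
    ... | z≤n = refl

    distToNeighbourClass : ∀ {u i m a} → i ≢ c u → Adj G u a → c a ≡ i →
      DistToClass G c u i m → m ≡ 1
    distToNeighbourClass {u} {i} i≢cu ua ca≡i du@((w , cw≡i , uw , _) , _) =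
      ≤-antisym (distToClass≤walk du ca≡i (step ua here)) (positive uw)
      where
      positive : ∀ {m} → Walk G u w m → 1 ≤ m
      positive here       = ⊥-elim (i≢cu (sym cw≡i))
      positive (step _ _) = s≤s z≤n

    -- Vertices of the same class agree on their own class, so it suffices to
    -- compare the distances to the other classes.
    sameVectorFromOtherClasses : ∀ {u v} → c u ≡ c v →
      (∀ i → i ≢ c u → ∀ m m′ → DistToClass G c u i m → DistToClass G c v i m′ → m ≡ m′) →
      SameVector u v
    sameVectorFromOtherClasses {u} {v} cu≡cv others i m m′ du dv with i ≟F c u
    ... | yes refl = trans (distToOwnClass du)
                           (sym (distToOwnClass (subst (λ j → DistToClass G c v j m′) cu≡cv dv)))
    ... | no i≢cu  = others i i≢cu m m′ du dv

    twinsSameVector : ∀ {u v} → c u ≡ c v → Twins G u v → Twins G v u → SameVector u v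
    twinsSameVector {u} {v} cu≡cv uv vu = sameVectorFromOtherClasses cu≡cv λ i i≢cu m m′ du dv →
      ≤-antisym (closer vu (λ eq → i≢cu (trans eq (sym cu≡cv))) du dv) (closer uv i≢cu dv du)
      where
      closer : ∀ {x y i m m′} → Twins G y x → i ≢ c y →
        DistToClass G c x i m → DistToClass G c y i m′ → m ≤ m′
      closer yx i≢cy dx ((w , cw≡i , yw , _) , _)
        with rerouteAtTwin yx yw (λ { refl → i≢cy (sym cw≡i) })
      ... | j′ , j′≤ , xw = ≤-trans (distToClass≤walk dx cw≡i xw) j′≤

    commonNeighboursSameVector : ∀ {u v} → c u ≡ c v →
      (∀ i → i ≢ c u → ∃[ a ] (c a ≡ i × Adj G u a × Adj G v a)) → SameVector u v
    commonNeighboursSameVector cu≡cv common = sameVectorFromOtherClasses cu≡cv λ i i≢cu m m′ du dv →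
      let (a , ca≡i , ua , va) = common i i≢cu in
      trans (distToNeighbourClass i≢cu ua ca≡i du)
            (sym (distToNeighbourClass (λ eq → i≢cu (trans eq (sym cu≡cv))) va ca≡i dv))

  locatingSeparates : ∀ {k} (Π : Partition G k) → Locating G Π →
    ∀ {u v} → u ≢ v → ¬ SameVector (proj₁ Π) u v
  locatingSeparates (c , _) locating u≢v same with locating _ _ u≢v
  ... | i , m , m′ , du , dv , m≢m′ = m≢m′ (same i m m′ du dv)

  twinSetInDistinctClasses : ∀ {k} (Π : Partition G k) → Locating G Π →
    ∀ {W} → TwinSet G W → ∀ u v → u ∈ W → v ∈ W → proj₁ Π u ≡ proj₁ Π v → u ≡ v
  twinSetInDistinctClasses Π@(c , _) locating twinSet u v u∈W v∈W cu≡cv with u ≟F v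
  ... | yes u≡v = u≡v
  ... | no  u≢v = ⊥-elim (locatingSeparates Π locating u≢v
                    (twinsSameVector _ cu≡cv (twinSet u v u∈W v∈W) (twinSet v u v∈W u∈W)))

  twinCliqueMeetingAllClasses : Connected G →
    ∀ {k} (Π : Partition G k) → Locating G Π →
    ∀ {W} → TwinSet G W → CliqueOn G W → (∀ i → ∃[ w ] (w ∈ W × proj₁ Π w ≡ i)) →
    ∀ x → x ∈ W
  twinCliqueMeetingAllClasses connected Π@(c , _) locating {W} twinSet clique meets x
    with x ∈? W | meets (c x)
  ... | yes x∈W | _ = x∈W
  ... | no  x∉W | w₀ , w₀∈W , _
    with crossingEdge W (proj₂ (connected x w₀)) x∉W w₀∈W
  ... | y , z , y∉W , z∈W , yz with meets (c y)
  ... | w , w∈W , cw≡cy =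
    ⊥-elim (locatingSeparates Π locating y≢w (commonNeighboursSameVector c (sym cw≡cy) common))
    where
    y≢w : y ≢ w
    y≢w refl = y∉W w∈W
    -- y is adjacent to all of W, and so is w (G[W] is complete), so both see
    -- the vertex of W in each other class
    common : ∀ i → i ≢ c y → ∃[ a ] (c a ≡ i × Adj G y a × Adj G w a)
    common i i≢cy with meets i
    ... | a , a∈W , ca≡i =
      a , ca≡i , adjacentToTwinSet twinSet y∉W z∈W yz a a∈W , clique w a w∈W a∈W w≢a
      where
      w≢a : w ≢ a
      w≢a refl = i≢cy (trans (sym ca≡i) cw≡cy)

meetsClass? : ∀ {n k} (W : Subset n) (c : Fin n → Fin k) i → Dec (∃[ w ] (w ∈ W × c w ≡ i))
meetsClass? W c i = any? (λ w → (w ∈? W) ×-dec (c w ≟F i))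

mainTheorem9 : ∀ {n : ℕ} (G : Graph n) → Connected G → ¬ Complete G →
    (W : Subset n) → TauSet G W → CliqueOn G W →
    ∀ (k : ℕ) (Π : Partition G k) → Locating G Π → suc ∣ W ∣ ≤ k
mainTheorem9 G connected ¬complete W (twinSet , _) clique k Π@(c , _) locating
  with all? (meetsClass? W c)
... | yes meets = ⊥-elim (¬complete λ u v → clique u v (spans u) (spans v))
  where
  spans : ∀ x → x ∈ W
  spans = twinCliqueMeetingAllClasses G connected Π locating twinSet clique meets
... | no ¬meets with ¬∀⟶∃¬ k _ (meetsClass? W c) ¬meets
... | i , missed =
  injectiveOnMissing⇒< W c i (twinSetInDistinctClasses G Π locating twinSet)
    (λ w w∈W cw≡i → missed (w , w∈W , cw≡i))
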